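{- Let $G=(V,E)$ be the complete graph on $n$ vertices with a positive self-loop at every vertex, where every edge is labelled $+$ or $-$. Let $y$ be the disagreement vector of a clustering that is optimal for the Min Max objective, and let $\mathsf{OPT}=\max_{z\in V}y(z)$. Then for every $u\in V$, \[ \sum_{v\in V}\widehat{d}_{uv}\le 8\cdot\mathsf{OPT}. \]
   Context: $E^+$ and $E^-$ denote the sets of positive and negative edges, and every vertex $v$ has a positive self-loop $(v,v)\in E^+$. For $u\in V$, $N_u^+=\{v\in V:(u,v)\in E^+\}$ and $N_u^-=\{v\in V:(u,v)\in E^-\}$; thus $u\in N_u^+$. A clustering is a partition of $V$. An edge $(u,v)$ is in disagreement if it is positive and $u,v$ lie in different clusters, or it is negative and $u,v$ lie in the same cluster. The disagreement vector $y$ of a clustering is given by $y(u)=$ the number of edges incident to $u$ in disagreement. The Min Max objective asks to minimize $\max_{u\in V}y(u)$ over all clusterings. The correlation metric is \[ d_{uv}=1-\frac{|N_u^+\cap N_v^+|}{n-|N_u^-\cap N_v^-|}, \qquad u,v\in V, \] where the denominator is positive by the self-loops. Set $\widehat{d}_{uv}=d_{uv}$ if $(u,v)\in E^+$ and $\widehat{d}_{uv}=1-d_{uv}$ if $(u,v)\in E^-$. -}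

module Defs where

open import Data.Bool using (Bool; true; false; _∧_; not; if_then_else_)
open import Data.Nat using (ℕ; zero; suc; _⊔_; _∸_; _≡ᵇ_)
open import Data.Fin using (Fin)
open import Data.List using (List; foldr; map)
open import Data.List using () renaming (allFin to allFinL)
open import Data.Integer using (+_)
open import Data.Rational using (ℚ; _/_; 0ℚ; 1ℚ; _-_; _+_)

-- Vertices are Fin n. A signed complete graph is a sign function
-- (true = positive edge, false = negative edge).
Signing : ℕ → Set
Signing n = Fin n → Fin n → Bool

-- Clustering: a partition of V given by cluster labels (any partition arises).
Clustering : ℕ → Set
Clustering n = Fin n → ℕ

vertices : (n : ℕ) → List (Fin n)
vertices n = allFinL n

countV : (n : ℕ) → (Fin n → Bool) → ℕ
countV n p = foldr (λ w k → if p w then suc k else k) 0 (vertices n)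

sameCluster : {n : ℕ} → Clustering n → Fin n → Fin n → Bool
sameCluster c u v = c u ≡ᵇ c v

disagrees : {n : ℕ} → Signing n → Clustering n → Fin n → Fin n → Bool
disagrees s c u v =
  if s u v then not (sameCluster c u v) else sameCluster c u v

disagreement : {n : ℕ} → Signing n → Clustering n → Fin n → ℕ
disagreement {n} s c u = countV n (disagrees s c u)

maxDisagreement : {n : ℕ} → Signing n → Clustering n → ℕ
maxDisagreement {n} s c = foldr (λ u k → disagreement s c u ⊔ k) 0 (vertices n)

IsMinMaxOptimal : {n : ℕ} → Signing n → Clustering n → Set
IsMinMaxOptimal {n} s c = (c' : Clustering n) →
  maxDisagreement s c Data.Nat.≤ maxDisagreement s c'

-- p / q as a rational; q = 0 never occurs for the correlation metric
-- (self-loops make the denominator positive), the value there is irrelevant.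
frac : ℕ → ℕ → ℚ
frac p zero = 0ℚ
frac p (suc q) = (+ p) / (suc q)

commonPos : {n : ℕ} → Signing n → Fin n → Fin n → ℕ
commonPos {n} s u v = countV n (λ w → s u w ∧ s v w)

commonNeg : {n : ℕ} → Signing n → Fin n → Fin n → ℕ
commonNeg {n} s u v = countV n (λ w → not (s u w) ∧ not (s v w))

corrMetric : {n : ℕ} → Signing n → Fin n → Fin n → ℚ
corrMetric {n} s u v = 1ℚ - frac (commonPos s u v) (n ∸ commonNeg s u v)

dHat : {n : ℕ} → Signing n → Fin n → Fin n → ℚ
dHat s u v = if s u v then corrMetric s u v else 1ℚ - corrMetric s u v

sumℚ : List ℚ → ℚ
sumℚ = foldr _+_ 0ℚ

module Submission where

-- Write d_uv = |N⁺u ∆ N⁺v| / |N⁺u ∪ N⁺v| and 1 - d_uv = |N⁺u ∩ N⁺v| / |N⁺u ∪ N⁺v|, and let OPT be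
-- the maximal disagreement of the given clustering.
-- A disagreeing edge uv contributes at most 1, in total y(u) ≤ OPT. A positive edge uv inside
-- a cluster has |N⁺u ∆ N⁺v| ≤ y(u) + y(v) ≤ 2 OPT, so it contributes at most 2 OPT / |N⁺u|,
-- in total 2 OPT. A negative edge uv between clusters contributes at most
-- Σ_{w ∈ N⁺u ∩ N⁺v} 1 / max(|N⁺u|, |N⁺v|). Exchanging the sums, a fixed w ∈ N⁺u collects at
-- most y(w) / |N⁺u| from the v with wv a positive edge between clusters and, if w lies outside
-- u's cluster, at most 3 OPT / k from the v in its own cluster, where k ≤ min(|N⁺u|, OPT) is
-- the number of such w: either |N⁺w| < 3 OPT, or every such v has
-- |N⁺v| ≥ |N⁺w| - 2 OPT ≥ |N⁺w| / 3. Altogether the sum is at most 7 OPT.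

open import Algebra.Bundles using (CommutativeMonoid)
open import Data.Bool using (Bool; true; false; T; not; _∧_; _∨_; _xor_; if_then_else_)
open import Data.Bool.Properties using (T-∧; T-∨; T-≡)
open import Data.Fin using (Fin)
import Data.Integer as ℤ
import Data.Integer.Properties as ℤP
open import Data.List using (List; []; _∷_; foldr; map; length)
open import Data.List.Membership.Propositional using (_∈_)
open import Data.List.Membership.Propositional.Properties using (∈-allFin)
open import Data.List.Properties using (length-tabulate)
open import Data.List.Relation.Unary.Any using (here; there)
open import Data.Nat using (ℕ; zero; suc; _+_; _*_; _∸_; _⊔_; _≤_; _<_; _≡ᵇ_; z≤n; s≤s; z<s)
import Data.Nat.Properties as ℕP
open import Data.Product using (proj₁)
open import Data.Rational as ℚ using (ℚ; 0ℚ; 1ℚ)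
import Data.Rational.Properties as ℚP
import Data.Rational.Unnormalised as ℚᵘ
import Data.Rational.Unnormalised.Properties as ℚᵘP
open import Data.Sum using (inj₁; inj₂)
open import Data.Unit using (tt)
open import Function using (id; _∘_; Equivalence)
open import Relation.Binary.PropositionalEquality
open import Relation.Nullary using (yes; no)

open import Defs

private
  toℚᵘ-frac : ∀ p q → ℚ.toℚᵘ (frac p (suc q)) ℚᵘ.≃ ℚᵘ.mkℚᵘ (ℤ.+ p) q
  toℚᵘ-frac p q = ℚP.toℚᵘ-fromℚᵘ (ℚᵘ.mkℚᵘ (ℤ.+ p) q)

  mkℚᵘ-+ : ∀ p p′ q →
    ℚᵘ.mkℚᵘ (ℤ.+ p) q ℚᵘ.+ ℚᵘ.mkℚᵘ (ℤ.+ p′) q ℚᵘ.≃ ℚᵘ.mkℚᵘ (ℤ.+ (p + p′)) q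
  mkℚᵘ-+ p p′ q = ℚᵘ.*≡* (begin
      (ℤ.+ p ℤ.* ℤ.+ d ℤ.+ ℤ.+ p′ ℤ.* ℤ.+ d) ℤ.* ℤ.+ d
        ≡⟨ solve 3 (λ p p′ d → (p :* d :+ p′ :* d) :* d := (p :+ p′) :* (d :* d))
                 refl (ℤ.+ p) (ℤ.+ p′) (ℤ.+ d) ⟩
      (ℤ.+ p ℤ.+ ℤ.+ p′) ℤ.* (ℤ.+ d ℤ.* ℤ.+ d)
        ≡⟨ cong₂ ℤ._*_ (ℤP.pos-+ p p′) (ℤP.pos-* d d) ⟨
      ℤ.+ (p + p′) ℤ.* ℤ.+ (d * d) ∎)
    where
    open ≡-Reasoning
    open import Data.Integer.Solver using (module +-*-Solver)
    open +-*-Solver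
    d = suc q

frac-mono : ∀ {p q p′ q′} → 0 < q → 0 < q′ → p * q′ ≤ p′ * q → frac p q ℚ.≤ frac p′ q′
frac-mono {p} {suc q} {p′} {suc q′} _ _ pq′≤p′q = ℚP.toℚᵘ-cancel-≤
  (ℚᵘP.≤-respʳ-≃ (ℚᵘP.≃-sym (toℚᵘ-frac p′ q′))
  (ℚᵘP.≤-respˡ-≃ (ℚᵘP.≃-sym (toℚᵘ-frac p q))
  (ℚᵘ.*≤* (subst₂ ℤ._≤_ (ℤP.pos-* p (suc q′)) (ℤP.pos-* p′ (suc q)) (ℤ.+≤+ pq′≤p′q)))))

-- frac p 0 = 0, so this and frac-zero need no positivity hypothesis on q.
frac-+ : ∀ p p′ q → frac p q ℚ.+ frac p′ q ≡ frac (p + p′) q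
frac-+ p p′ zero = refl
frac-+ p p′ (suc q) = ℚP.toℚᵘ-injective
  (ℚᵘP.≃-trans (ℚP.toℚᵘ-homo-+ (frac p (suc q)) (frac p′ (suc q)))
  (ℚᵘP.≃-trans (ℚᵘP.+-cong (toℚᵘ-frac p q) (toℚᵘ-frac p′ q))
  (ℚᵘP.≃-trans (mkℚᵘ-+ p p′ q) (ℚᵘP.≃-sym (toℚᵘ-frac (p + p′) q)))))

frac-zero : ∀ q → frac 0 q ≡ 0ℚ
frac-zero zero = refl
frac-zero (suc q) = ℚP.0/n≡0 (suc q)

frac-nonneg : ∀ p q → 0ℚ ℚ.≤ frac p q
frac-nonneg p zero = ℚP.≤-refl
frac-nonneg p (suc q) = subst (ℚ._≤ frac p (suc q)) (frac-zero 1) (frac-mono {0} {1} {p} {suc q} z<s z<s z≤n)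

frac-monoˡ : ∀ {p p′} q → p ≤ p′ → frac p q ℚ.≤ frac p′ q
frac-monoˡ zero _ = ℚP.≤-refl
frac-monoˡ {p} {p′} (suc q) p≤p′ = frac-mono {p} {suc q} {p′} {suc q} z<s z<s (ℕP.*-monoˡ-≤ (suc q) p≤p′)

frac-antimonoʳ : ∀ p {q q′} → 0 < q → q ≤ q′ → frac p q′ ℚ.≤ frac p q
frac-antimonoʳ p {q} {q′} 0<q q≤q′ =
  frac-mono {p} {q′} {p} {q} (ℕP.<-≤-trans 0<q q≤q′) 0<q (ℕP.*-monoʳ-≤ p q≤q′)

frac-≤-1 : ∀ {p q} → 0 < q → p ≤ q → frac p q ℚ.≤ 1ℚ
frac-≤-1 {p} {q} 0<q p≤q = frac-mono {p} {q} {1} {1} 0<q z<s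
  (subst₂ _≤_ (sym (ℕP.*-identityʳ p)) (sym (ℕP.+-identityʳ q)) p≤q)

frac-*-cancel-≤ : ∀ k m → frac (k * m) k ℚ.≤ frac m 1
frac-*-cancel-≤ zero m = frac-nonneg m 1
frac-*-cancel-≤ (suc k) m = frac-mono {suc k * m} {suc k} {m} {1} z<s z<s
  (ℕP.≤-reflexive (trans (ℕP.*-identityʳ (suc k * m)) (ℕP.*-comm (suc k) m)))

1-frac : ∀ {p q} → 0 < q → p ≤ q → 1ℚ ℚ.- frac p q ≡ frac (q ∸ p) q
1-frac {p} {q} 0<q p≤q = begin
  1ℚ ℚ.- frac p q                          ≡⟨ cong (ℚ._- frac p q) frac-q-q ⟨
  frac q q ℚ.- frac p q                    ≡⟨ cong (λ m → frac m q ℚ.- frac p q) (ℕP.m∸n+n≡m p≤q) ⟨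
  frac (q ∸ p + p) q ℚ.- frac p q          ≡⟨ cong (ℚ._- frac p q) (frac-+ (q ∸ p) p q) ⟨
  frac (q ∸ p) q ℚ.+ frac p q ℚ.- frac p q ≡⟨ //-rightDividesʳ (frac p q) (frac (q ∸ p) q) ⟩
  frac (q ∸ p) q                           ∎
  where
  open ≡-Reasoning
  open import Algebra.Properties.Group ℚP.+-0-group using (//-rightDividesʳ)
  frac-q-q : frac q q ≡ 1ℚ
  frac-q-q = ℚP.≤-antisym (frac-≤-1 0<q ℕP.≤-refl)
                          (frac-mono {1} {1} {q} {q} z<s 0<q (ℕP.≤-reflexive (ℕP.*-comm 1 q)))

1-[1-p]≡p : ∀ p → 1ℚ ℚ.- (1ℚ ℚ.- p) ≡ p
1-[1-p]≡p p = solve 1 (λ p → con 1ℚ :- (con 1ℚ :- p) := p) refl p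
  where
  open import Data.Rational.Solver using (module +-*-Solver)
  open +-*-Solver

≤-+-nonneg : ∀ {p q r} → p ℚ.≤ q → 0ℚ ℚ.≤ r → p ℚ.≤ q ℚ.+ r
≤-+-nonneg {p} {q} {r} p≤q 0≤r = subst (ℚ._≤ q ℚ.+ r) (ℚP.+-identityʳ p) (ℚP.+-mono-≤ p≤q 0≤r)

≤-nonneg-+ : ∀ {p q r} → p ℚ.≤ q → 0ℚ ℚ.≤ r → p ℚ.≤ r ℚ.+ q
≤-nonneg-+ {p} {q} {r} p≤q 0≤r = subst (ℚ._≤ r ℚ.+ q) (ℚP.+-identityˡ p) (ℚP.+-mono-≤ 0≤r p≤q)

[_]·_ : Bool → ℚ → ℚ
[ b ]· r = if b then r else 0ℚ

[]·-nonneg : ∀ b {r} → 0ℚ ℚ.≤ r → 0ℚ ℚ.≤ [ b ]· r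
[]·-nonneg true 0≤r = 0≤r
[]·-nonneg false _ = ℚP.≤-refl

[]·-mono : ∀ b {r r′} → (T b → r ℚ.≤ r′) → [ b ]· r ℚ.≤ [ b ]· r′
[]·-mono true r≤r′ = r≤r′ tt
[]·-mono false _ = ℚP.≤-refl

[]·-∧-≤ : ∀ b b′ {r r′} → 0ℚ ℚ.≤ r′ → (T b → T b′ → r ℚ.≤ r′) →
          [ b ∧ b′ ]· r ℚ.≤ [ b ]· r′
[]·-∧-≤ true true 0≤r′ r≤r′ = r≤r′ tt tt
[]·-∧-≤ true false 0≤r′ _ = 0≤r′
[]·-∧-≤ false b′ _ _ = ℚP.≤-refl

module _ {A : Set} where

  Σ : List A → (A → ℚ) → ℚ
  Σ xs f = sumℚ (map f xs)

  count : (A → Bool) → List A → ℕ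
  count P = foldr (λ x k → if P x then suc k else k) 0

  Σ-mono : ∀ xs {f g : A → ℚ} → (∀ x → f x ℚ.≤ g x) → Σ xs f ℚ.≤ Σ xs g
  Σ-mono [] f≤g = ℚP.≤-refl
  Σ-mono (x ∷ xs) f≤g = ℚP.+-mono-≤ (f≤g x) (Σ-mono xs f≤g)

  Σ-cong : ∀ xs {f g : A → ℚ} → (∀ x → f x ≡ g x) → Σ xs f ≡ Σ xs g
  Σ-cong [] f≡g = refl
  Σ-cong (x ∷ xs) f≡g = cong₂ ℚ._+_ (f≡g x) (Σ-cong xs f≡g)

  Σ-zero : ∀ xs → Σ xs (λ _ → 0ℚ) ≡ 0ℚ
  Σ-zero [] = refl
  Σ-zero (x ∷ xs) = trans (ℚP.+-identityˡ (Σ xs (λ _ → 0ℚ))) (Σ-zero xs)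

  Σ-+ : ∀ xs (f g : A → ℚ) → Σ xs (λ x → f x ℚ.+ g x) ≡ Σ xs f ℚ.+ Σ xs g
  Σ-+ [] f g = refl
  Σ-+ (x ∷ xs) f g = trans (cong (f x ℚ.+ g x ℚ.+_) (Σ-+ xs f g)) (interchange (f x) (g x) (Σ xs f) (Σ xs g))
    where
    open import Algebra.Properties.CommutativeSemigroup
      (CommutativeMonoid.commutativeSemigroup ℚP.+-0-commutativeMonoid) using (interchange)

  Σ-comm : ∀ (xs ys : List A) (f : A → A → ℚ) →
           Σ xs (λ x → Σ ys (f x)) ≡ Σ ys (λ y → Σ xs (λ x → f x y))
  Σ-comm [] ys f = sym (Σ-zero ys)
  Σ-comm (x ∷ xs) ys f =
    trans (cong (Σ ys (f x) ℚ.+_) (Σ-comm xs ys f)) (sym (Σ-+ ys (f x) (λ y → Σ xs (λ x → f x y))))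

  []·-Σ : ∀ b xs (f : A → ℚ) → [ b ]· Σ xs f ≡ Σ xs (λ x → [ b ]· f x)
  []·-Σ true xs f = refl
  []·-Σ false xs f = sym (Σ-zero xs)

  Σ-[]·-frac : ∀ xs (P : A → Bool) m q → Σ xs (λ x → [ P x ]· frac m q) ≡ frac (count P xs * m) q
  Σ-[]·-frac [] P m q = sym (frac-zero q)
  Σ-[]·-frac (x ∷ xs) P m q with P x
  ... | true = trans (cong (frac m q ℚ.+_) (Σ-[]·-frac xs P m q)) (frac-+ m (count P xs * m) q)
  ... | false = trans (ℚP.+-identityˡ _) (Σ-[]·-frac xs P m q)

  count-mono : ∀ xs {P R : A → Bool} → (∀ x → T (P x) → T (R x)) → count P xs ≤ count R xs
  count-mono [] P⇒R = z≤n
  count-mono (x ∷ xs) {P} {R} P⇒R with P x | R x | P⇒R x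
  ... | true  | true  | _ = s≤s (count-mono xs P⇒R)
  ... | true  | false | P⇒Rx with () ← P⇒Rx tt
  ... | false | true  | _ = ℕP.m≤n⇒m≤1+n (count-mono xs P⇒R)
  ... | false | false | _ = count-mono xs P⇒R

  count-cong : ∀ xs {P R : A → Bool} → (∀ x → P x ≡ R x) → count P xs ≡ count R xs
  count-cong [] P≡R = refl
  count-cong (x ∷ xs) P≡R rewrite P≡R x | count-cong xs P≡R = refl

  count-∨ : ∀ xs (P R : A → Bool) → count (λ x → P x ∨ R x) xs ≤ count P xs + count R xs
  count-∨ [] P R = z≤n
  count-∨ (x ∷ xs) P R with P x | R x
  ... | true  | true  = s≤s (ℕP.≤-trans (count-∨ xs P R) (ℕP.+-monoʳ-≤ (count P xs) (ℕP.n≤1+n _)))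
  ... | true  | false = s≤s (count-∨ xs P R)
  ... | false | true  = ℕP.≤-trans (s≤s (count-∨ xs P R)) (ℕP.≤-reflexive (sym (ℕP.+-suc _ _)))
  ... | false | false = count-∨ xs P R

  count-∨≡count-∧+count-xor : ∀ xs (P R : A → Bool) →
    count (λ x → P x ∨ R x) xs ≡ count (λ x → P x ∧ R x) xs + count (λ x → P x xor R x) xs
  count-∨≡count-∧+count-xor [] P R = refl
  count-∨≡count-∧+count-xor (x ∷ xs) P R with P x | R x
  ... | true  | true  = cong suc (count-∨≡count-∧+count-xor xs P R)
  ... | true  | false = trans (cong suc (count-∨≡count-∧+count-xor xs P R)) (sym (ℕP.+-suc _ _))
  ... | false | true  = trans (cong suc (count-∨≡count-∧+count-xor xs P R)) (sym (ℕP.+-suc _ _))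
  ... | false | false = count-∨≡count-∧+count-xor xs P R

  count+count-not≡length : ∀ xs (P : A → Bool) → count P xs + count (λ x → not (P x)) xs ≡ length xs
  count+count-not≡length [] P = refl
  count+count-not≡length (x ∷ xs) P with P x
  ... | true  = cong suc (count+count-not≡length xs P)
  ... | false = trans (ℕP.+-suc _ _) (cong suc (count+count-not≡length xs P))

  count-pos : ∀ {xs x} (P : A → Bool) → x ∈ xs → T (P x) → 0 < count P xs
  count-pos {x ∷ xs} P (here refl) Px with P x
  ... | true = z<s
  count-pos {y ∷ xs} P (there x∈xs) Px with P y
  ... | true  = z<s
  ... | false = count-pos P x∈xs Px

  ≤-foldr-⊔ : ∀ {xs x} (f : A → ℕ) → x ∈ xs → f x ≤ foldr (λ y k → f y ⊔ k) 0 xs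
  ≤-foldr-⊔ f (here refl) = ℕP.m≤m⊔n _ _
  ≤-foldr-⊔ {y ∷ xs} f (there x∈xs) = ℕP.m≤n⇒m≤o⊔n (f y) (≤-foldr-⊔ f x∈xs)

m≤3*n : ∀ {m n o} → 3 * o ≤ m → m ≤ n + 2 * o → m ≤ 3 * n
m≤3*n {m} {n} {o} 3o≤m m≤n+2o = ℕP.+-cancelʳ-≤ (2 * m) m (3 * n) (begin
    m + 2 * m            ≡⟨ solve 1 (λ m → m :+ con 2 :* m := con 3 :* m) refl m ⟩
    3 * m                ≤⟨ ℕP.*-monoʳ-≤ 3 m≤n+2o ⟩
    3 * (n + 2 * o)      ≡⟨ solve 2 (λ n o → con 3 :* (n :+ con 2 :* o) := con 3 :* n :+ con 2 :* (con 3 :* o))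
                                  refl n o ⟩
    3 * n + 2 * (3 * o)  ≤⟨ ℕP.+-monoʳ-≤ (3 * n) (ℕP.*-monoʳ-≤ 2 3o≤m) ⟩
    3 * n + 2 * m        ∎)
  where
  open ℕP.≤-Reasoning
  open import Data.Nat.Solver using (module +-*-Solver)
  open +-*-Solver

module Disagreements {n : ℕ} (s : Signing n) (c : Clustering n) where

  V : List (Fin n)
  V = vertices n

  y : Fin n → ℕ
  y = disagreement s c

  OPT : ℕ
  OPT = maxDisagreement s c

  deg⁺ : Fin n → ℕ
  deg⁺ v = countV n (s v)

  cut⁺ inside⁺ cut⁻ : Fin n → Fin n → Bool
  cut⁺ u v = s u v ∧ not (sameCluster c u v)
  inside⁺ u v = s u v ∧ sameCluster c u v
  cut⁻ u v = not (s u v) ∧ not (sameCluster c u v)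

  same⇒≡ : ∀ {u v} → T (sameCluster c u v) → c u ≡ c v
  same⇒≡ {u} {v} = ℕP.≡ᵇ⇒≡ (c u) (c v)

  y≤OPT : ∀ w → y w ≤ OPT
  y≤OPT w = ≤-foldr-⊔ y (∈-allFin w)

  count-cut⁺≤OPT : ∀ w → count (cut⁺ w) V ≤ OPT
  count-cut⁺≤OPT w = ℕP.≤-trans (count-mono V λ v → cut⁺⇒disagrees (s w v)) (y≤OPT w)
    where
    cut⁺⇒disagrees : ∀ a {m} → T (a ∧ not m) → T (if a then not m else m)
    cut⁺⇒disagrees true cut = cut

  symmetric-difference≤2*OPT : ∀ {u v} → c u ≡ c v → count (λ w → s u w xor s v w) V ≤ 2 * OPT
  symmetric-difference≤2*OPT {u} {v} cu≡cv = begin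
    count (λ w → s u w xor s v w) V                        ≤⟨ count-mono V xor⇒disagreement ⟩
    count (λ w → disagrees s c u w ∨ disagrees s c v w) V  ≤⟨ count-∨ V (disagrees s c u) (disagrees s c v) ⟩
    y u + y v                                              ≤⟨ ℕP.+-mono-≤ (y≤OPT u) (y≤OPT v) ⟩
    OPT + OPT                                              ≡⟨ cong (OPT +_) (ℕP.+-identityʳ OPT) ⟨
    2 * OPT                                                ∎
    where
    open ℕP.≤-Reasoning
    either-disagrees : ∀ a b m → T (a xor b) → T ((if a then not m else m) ∨ (if b then not m else m))
    either-disagrees true  false true  _ = tt
    either-disagrees true  false false _ = tt
    either-disagrees false true  true  _ = tt
    either-disagrees false true  false _ = tt
    xor⇒disagreement : ∀ w → T (s u w xor s v w) → T (disagrees s c u w ∨ disagrees s c v w)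
    xor⇒disagreement w rewrite sym cu≡cv = either-disagrees (s u w) (s v w) (sameCluster c u w)

  deg⁺≤deg⁺+2*OPT : ∀ {w v} → c w ≡ c v → deg⁺ w ≤ deg⁺ v + 2 * OPT
  deg⁺≤deg⁺+2*OPT {w} {v} cw≡cv = begin
    deg⁺ w                                     ≤⟨ count-mono V (λ x → in-union (s w x) (s v x)) ⟩
    count (λ x → s v x ∨ (s w x xor s v x)) V  ≤⟨ count-∨ V (s v) (λ x → s w x xor s v x) ⟩
    deg⁺ v + count (λ x → s w x xor s v x) V
      ≤⟨ ℕP.+-monoʳ-≤ (deg⁺ v) (symmetric-difference≤2*OPT cw≡cv) ⟩
    deg⁺ v + 2 * OPT                           ∎
    where
    open ℕP.≤-Reasoning
    in-union : ∀ a b → T a → T (b ∨ (a xor b))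
    in-union true true _ = tt
    in-union true false _ = tt

module CorrelationMetric {n : ℕ} (s : Signing n) where

  union⁺ symmetric-difference⁺ : Fin n → Fin n → ℕ
  union⁺ u v = countV n (λ w → s u w ∨ s v w)
  symmetric-difference⁺ u v = countV n (λ w → s u w xor s v w)

  union⁺-pos : ∀ {u} v → T (s u u) → 0 < union⁺ u v
  union⁺-pos {u} v suu = count-pos (λ w → s u w ∨ s v w) (∈-allFin u) (Equivalence.from T-∨ (inj₁ suu))

  union⁺≡commonPos+symmetric-difference⁺ : ∀ u v → union⁺ u v ≡ commonPos s u v + symmetric-difference⁺ u v
  union⁺≡commonPos+symmetric-difference⁺ u v = count-∨≡count-∧+count-xor (vertices n) (s u) (s v)

  commonPos≤union⁺ : ∀ u v → commonPos s u v ≤ union⁺ u v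
  commonPos≤union⁺ u v = ℕP.≤-trans (ℕP.m≤m+n (commonPos s u v) (symmetric-difference⁺ u v))
    (ℕP.≤-reflexive (sym (union⁺≡commonPos+symmetric-difference⁺ u v)))

  symmetric-difference⁺≤union⁺ : ∀ u v → symmetric-difference⁺ u v ≤ union⁺ u v
  symmetric-difference⁺≤union⁺ u v = ℕP.≤-trans (ℕP.m≤n+m (symmetric-difference⁺ u v) (commonPos s u v))
    (ℕP.≤-reflexive (sym (union⁺≡commonPos+symmetric-difference⁺ u v)))

  n∸commonNeg≡union⁺ : ∀ u v → n ∸ commonNeg s u v ≡ union⁺ u v
  n∸commonNeg≡union⁺ u v = begin
    n ∸ commonNeg s u v
      ≡⟨ cong₂ _∸_ n≡union⁺+outside commonNeg≡outside ⟩
    union⁺ u v + count outside (vertices n) ∸ count outside (vertices n)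
      ≡⟨ ℕP.m+n∸n≡m (union⁺ u v) (count outside (vertices n)) ⟩
    union⁺ u v ∎
    where
    open ≡-Reasoning
    outside : Fin n → Bool
    outside w = not (s u w ∨ s v w)
    n≡union⁺+outside : n ≡ union⁺ u v + count outside (vertices n)
    n≡union⁺+outside =
      sym (trans (count+count-not≡length (vertices n) (λ w → s u w ∨ s v w)) (length-tabulate id))
    not-∧-not : ∀ a b → not a ∧ not b ≡ not (a ∨ b)
    not-∧-not true b = refl
    not-∧-not false b = refl
    commonNeg≡outside : commonNeg s u v ≡ count outside (vertices n)
    commonNeg≡outside = count-cong (vertices n) λ w → not-∧-not (s u w) (s v w)

  corrMetric≡ : ∀ {u} v → T (s u u) → corrMetric s u v ≡ frac (symmetric-difference⁺ u v) (union⁺ u v)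
  corrMetric≡ {u} v suu = begin
    1ℚ ℚ.- frac ∩ (n ∸ commonNeg s u v)  ≡⟨ cong (λ q → 1ℚ ℚ.- frac ∩ q) (n∸commonNeg≡union⁺ u v) ⟩
    1ℚ ℚ.- frac ∩ ∪                      ≡⟨ 1-frac (union⁺-pos v suu) (commonPos≤union⁺ u v) ⟩
    frac (∪ ∸ ∩) ∪                       ≡⟨ cong (λ p → frac (p ∸ ∩) ∪) ∪≡∩+∆ ⟩
    frac (∩ + ∆ ∸ ∩) ∪                   ≡⟨ cong (λ p → frac p ∪) (ℕP.m+n∸m≡n ∩ ∆) ⟩
    frac ∆ ∪                             ∎
    where
    open ≡-Reasoning
    ∩ = commonPos s u v
    ∪ = union⁺ u v
    ∆ = symmetric-difference⁺ u v
    ∪≡∩+∆ = union⁺≡commonPos+symmetric-difference⁺ u v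

  1-corrMetric≡ : ∀ u v → 1ℚ ℚ.- corrMetric s u v ≡ frac (commonPos s u v) (union⁺ u v)
  1-corrMetric≡ u v = trans (1-[1-p]≡p _) (cong (frac (commonPos s u v)) (n∸commonNeg≡union⁺ u v))

  corrMetric≤1 : ∀ {u} v → T (s u u) → corrMetric s u v ℚ.≤ 1ℚ
  corrMetric≤1 {u} v suu = subst (ℚ._≤ 1ℚ) (sym (corrMetric≡ v suu))
    (frac-≤-1 (union⁺-pos v suu) (symmetric-difference⁺≤union⁺ u v))

  1-corrMetric≤1 : ∀ {u} v → T (s u u) → 1ℚ ℚ.- corrMetric s u v ℚ.≤ 1ℚ
  1-corrMetric≤1 {u} v suu = subst (ℚ._≤ 1ℚ) (sym (1-corrMetric≡ u v))
    (frac-≤-1 (union⁺-pos v suu) (commonPos≤union⁺ u v))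

module _ {r r′ : ℚ} (0≤r : 0ℚ ℚ.≤ r) (r≤r′ : r ℚ.≤ r′) where

  private
    weights-nonneg : ∀ a b a′ b′ → 0ℚ ℚ.≤ [ a ]· ([ b ]· r′) ℚ.+ [ a′ ]· ([ b′ ]· r)
    weights-nonneg a b a′ b′ =
      ℚP.+-mono-≤ ([]·-nonneg a ([]·-nonneg b (ℚP.≤-trans 0≤r r≤r′)))
                  ([]·-nonneg a′ ([]·-nonneg b′ 0≤r))

  -- For vertices u, v, w with suv = s u v, muv = [u and v share a cluster], etc.: if uv is a
  -- negative edge leaving u's cluster and w ∈ N⁺u ∩ N⁺v, then wv leaves w's cluster when w is in
  -- u's cluster, and otherwise wv either leaves w's cluster or is a positive edge inside it.
  cut⁻-weight-≤ : ∀ suv muv suw svw swv muw mwv → swv ≡ svw → (T muw → mwv ≡ muv) →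
    [ not suv ∧ not muv ]· ([ suw ∧ svw ]· r)
      ℚ.≤ [ suw ]· ([ swv ∧ not mwv ]· r′) ℚ.+ [ suw ∧ not muw ]· ([ swv ∧ mwv ]· r)
  cut⁻-weight-≤ false false true true .true true mwv refl mwv≡muv with refl ← mwv≡muv tt =
    ≤-+-nonneg r≤r′ ℚP.≤-refl
  cut⁻-weight-≤ false false true true .true false true  refl _ = ≤-nonneg-+ ℚP.≤-refl ℚP.≤-refl
  cut⁻-weight-≤ false false true true .true false false refl _ = ≤-+-nonneg r≤r′ ℚP.≤-refl
  cut⁻-weight-≤ false false true  false swv muw mwv _ _ = weights-nonneg true (swv ∧ not mwv) (not muw) (swv ∧ mwv)
  cut⁻-weight-≤ false false false svw   swv muw mwv _ _ = weights-nonneg false (swv ∧ not mwv) false (swv ∧ mwv)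
  cut⁻-weight-≤ false true  suw   svw   swv muw mwv _ _ =
    weights-nonneg suw (swv ∧ not mwv) (suw ∧ not muw) (swv ∧ mwv)
  cut⁻-weight-≤ true  muv   suw   svw   swv muw mwv _ _ =
    weights-nonneg suw (swv ∧ not mwv) (suw ∧ not muw) (swv ∧ mwv)

module AtVertex {n : ℕ} (s : Signing n) (symm : ∀ u v → s u v ≡ s v u) (loop : ∀ u → s u u ≡ true)
                (c : Clustering n) (u : Fin n) where

  open Disagreements s c
  open CorrelationMetric s

  s-loop : ∀ w → T (s w w)
  s-loop w = Equivalence.from T-≡ (loop w)

  0<deg⁺ : ∀ w → 0 < deg⁺ w
  0<deg⁺ w = count-pos (s w) (∈-allFin w) (s-loop w)

  a : ℕ
  a = deg⁺ u

  0<a⊔deg⁺ : ∀ v → 0 < a ⊔ deg⁺ v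
  0<a⊔deg⁺ v = ℕP.<-≤-trans (0<deg⁺ u) (ℕP.m≤m⊔n a (deg⁺ v))

  a⊔deg⁺≤union⁺ : ∀ v → a ⊔ deg⁺ v ≤ union⁺ u v
  a⊔deg⁺≤union⁺ v = ℕP.⊔-lub (count-mono V λ w suw → Equivalence.from T-∨ (inj₁ suw))
                             (count-mono V λ w svw → Equivalence.from T-∨ (inj₂ svw))

  weight : Fin n → ℚ
  weight v = frac 1 (a ⊔ deg⁺ v)

  weight≤1/a : ∀ v → weight v ℚ.≤ frac 1 a
  weight≤1/a v = frac-antimonoʳ 1 (0<deg⁺ u) (ℕP.m≤m⊔n a (deg⁺ v))

  weight≤3/deg⁺ : ∀ {w v} → 3 * OPT ≤ deg⁺ w → T (sameCluster c w v) → weight v ℚ.≤ frac 3 (deg⁺ w)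
  weight≤3/deg⁺ {w} {v} 3*OPT≤deg⁺w same =
    frac-mono {1} {a ⊔ deg⁺ v} {3} {deg⁺ w} (0<a⊔deg⁺ v) (0<deg⁺ w) (begin
      1 * deg⁺ w        ≡⟨ ℕP.*-identityˡ (deg⁺ w) ⟩
      deg⁺ w            ≤⟨ m≤3*n {deg⁺ w} {deg⁺ v} {OPT} 3*OPT≤deg⁺w (deg⁺≤deg⁺+2*OPT (same⇒≡ same)) ⟩
      3 * deg⁺ v        ≤⟨ ℕP.*-monoʳ-≤ 3 (ℕP.m≤n⊔m a (deg⁺ v)) ⟩
      3 * (a ⊔ deg⁺ v)  ∎)
    where open ℕP.≤-Reasoning

  cut⁻-term : Fin n → ℚ
  cut⁻-term v = [ cut⁻ u v ]· frac (commonPos s u v) (a ⊔ deg⁺ v)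

  corrMetric≤2*OPT/a : ∀ {v} → c u ≡ c v → corrMetric s u v ℚ.≤ frac (2 * OPT) a
  corrMetric≤2*OPT/a {v} cu≡cv = subst (ℚ._≤ frac (2 * OPT) a) (sym (corrMetric≡ v (s-loop u)))
    (frac-mono (union⁺-pos v (s-loop u)) (0<deg⁺ u)
      (ℕP.*-mono-≤ (symmetric-difference≤2*OPT cu≡cv)
                   (ℕP.≤-trans (ℕP.m≤m⊔n a (deg⁺ v)) (a⊔deg⁺≤union⁺ v))))

  1-corrMetric≤ : ∀ v → 1ℚ ℚ.- corrMetric s u v ℚ.≤ frac (commonPos s u v) (a ⊔ deg⁺ v)
  1-corrMetric≤ v = subst (ℚ._≤ frac (commonPos s u v) (a ⊔ deg⁺ v)) (sym (1-corrMetric≡ u v))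
    (frac-antimonoʳ (commonPos s u v) (0<a⊔deg⁺ v) (a⊔deg⁺≤union⁺ v))

  dHat-≤ : ∀ v →
    dHat s u v ℚ.≤ [ disagrees s c u v ]· 1ℚ ℚ.+ [ s u v ]· frac (2 * OPT) a ℚ.+ cut⁻-term v
  dHat-≤ v with s u v | sameCluster c u v in same
  ... | true  | true  =
    ≤-+-nonneg (≤-nonneg-+ (corrMetric≤2*OPT/a (same⇒≡ (Equivalence.from T-≡ same))) ℚP.≤-refl)
               ℚP.≤-refl
  ... | true  | false =
    ≤-+-nonneg (≤-+-nonneg (corrMetric≤1 v (s-loop u)) (frac-nonneg (2 * OPT) a)) ℚP.≤-refl
  ... | false | true  = ≤-+-nonneg (≤-+-nonneg (1-corrMetric≤1 v (s-loop u)) ℚP.≤-refl) ℚP.≤-refl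
  ... | false | false = ≤-nonneg-+ (1-corrMetric≤ v) ℚP.≤-refl

  Σ-disagrees≤ : Σ V (λ v → [ disagrees s c u v ]· 1ℚ) ℚ.≤ frac OPT 1
  Σ-disagrees≤ = subst (ℚ._≤ frac OPT 1) (sym (Σ-[]·-frac V (disagrees s c u) 1 1))
    (frac-monoˡ 1 (ℕP.≤-trans (ℕP.≤-reflexive (ℕP.*-identityʳ (y u))) (y≤OPT u)))

  Σ-positive≤ : Σ V (λ v → [ s u v ]· frac (2 * OPT) a) ℚ.≤ frac (2 * OPT) 1
  Σ-positive≤ = subst (ℚ._≤ frac (2 * OPT) 1) (sym (Σ-[]·-frac V (s u) (2 * OPT) a))
    (frac-*-cancel-≤ a (2 * OPT))

  Σ-cut⁺≤ : ∀ w → Σ V (λ v → [ cut⁺ w v ]· frac 1 a) ℚ.≤ frac OPT a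
  Σ-cut⁺≤ w = subst (ℚ._≤ frac OPT a) (sym (Σ-[]·-frac V (cut⁺ w) 1 a))
    (frac-monoˡ a (ℕP.≤-trans (ℕP.≤-reflexive (ℕP.*-identityʳ _)) (count-cut⁺≤OPT w)))

  Σ-inside⁺≤ : ∀ w {k} → 0 < k → k ≤ a → k ≤ OPT →
    Σ V (λ v → [ inside⁺ w v ]· weight v) ℚ.≤ frac (3 * OPT) k
  Σ-inside⁺≤ w {k} 0<k k≤a k≤OPT with 3 * OPT ℕP.≤? deg⁺ w
  ... | yes 3*OPT≤deg⁺w = begin
    Σ V (λ v → [ inside⁺ w v ]· weight v)
      ≤⟨ Σ-mono V (λ v → []·-∧-≤ (s w v) _ (frac-nonneg 3 (deg⁺ w)) λ _ → weight≤3/deg⁺ 3*OPT≤deg⁺w) ⟩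
    Σ V (λ v → [ s w v ]· frac 3 (deg⁺ w))
      ≡⟨ Σ-[]·-frac V (s w) 3 (deg⁺ w) ⟩
    frac (deg⁺ w * 3) (deg⁺ w)
      ≤⟨ frac-*-cancel-≤ (deg⁺ w) 3 ⟩
    frac 3 1
      ≤⟨ frac-mono {3} {1} {3 * OPT} {k} z<s 0<k
           (ℕP.≤-trans (ℕP.*-monoʳ-≤ 3 k≤OPT) (ℕP.≤-reflexive (sym (ℕP.*-identityʳ (3 * OPT))))) ⟩
    frac (3 * OPT) k ∎
    where open ℚP.≤-Reasoning
  ... | no 3*OPT≰deg⁺w = begin
    Σ V (λ v → [ inside⁺ w v ]· weight v)
      ≤⟨ Σ-mono V (λ v → []·-∧-≤ (s w v) _ (frac-nonneg 1 a) λ _ _ → weight≤1/a v) ⟩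
    Σ V (λ v → [ s w v ]· frac 1 a)
      ≡⟨ Σ-[]·-frac V (s w) 1 a ⟩
    frac (deg⁺ w * 1) a
      ≤⟨ frac-mono {deg⁺ w * 1} {a} {3 * OPT} {k} (0<deg⁺ u) 0<k (ℕP.*-mono-≤ deg⁺w*1≤3*OPT k≤a) ⟩
    frac (3 * OPT) k ∎
    where
    open ℚP.≤-Reasoning
    deg⁺w*1≤3*OPT : deg⁺ w * 1 ≤ 3 * OPT
    deg⁺w*1≤3*OPT =
      ℕP.≤-trans (ℕP.≤-reflexive (ℕP.*-identityʳ (deg⁺ w))) (ℕP.<⇒≤ (ℕP.≰⇒> 3*OPT≰deg⁺w))

  k : ℕ
  k = count (cut⁺ u) V

  Σ-common-neighbour≤ : ∀ w → Σ V (λ v → [ cut⁻ u v ]· ([ s u w ∧ s v w ]· weight v))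
                               ℚ.≤ [ s u w ]· frac OPT a ℚ.+ [ cut⁺ u w ]· frac (3 * OPT) k
  Σ-common-neighbour≤ w = begin
    Σ V (λ v → [ cut⁻ u v ]· ([ s u w ∧ s v w ]· weight v))
      ≤⟨ Σ-mono V (λ v → cut⁻-weight-≤ (frac-nonneg 1 (a ⊔ deg⁺ v)) (weight≤1/a v)
            (s u v) (sameCluster c u v) (s u w) (s v w) (s w v) (sameCluster c u w) (sameCluster c w v)
            (symm w v) (λ uw → cong (_≡ᵇ c v) (sym (same⇒≡ uw)))) ⟩
    Σ V (λ v → [ s u w ]· ([ cut⁺ w v ]· frac 1 a) ℚ.+ [ cut⁺ u w ]· ([ inside⁺ w v ]· weight v))
      ≡⟨ Σ-+ V _ _ ⟩
    Σ V (λ v → [ s u w ]· ([ cut⁺ w v ]· frac 1 a))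
      ℚ.+ Σ V (λ v → [ cut⁺ u w ]· ([ inside⁺ w v ]· weight v))
      ≡⟨ cong₂ ℚ._+_ ([]·-Σ (s u w) V _) ([]·-Σ (cut⁺ u w) V _) ⟨
    [ s u w ]· Σ V (λ v → [ cut⁺ w v ]· frac 1 a)
      ℚ.+ [ cut⁺ u w ]· Σ V (λ v → [ inside⁺ w v ]· weight v)
      ≤⟨ ℚP.+-mono-≤ ([]·-mono (s u w) λ _ → Σ-cut⁺≤ w) ([]·-mono (cut⁺ u w) λ uw →
           Σ-inside⁺≤ w (count-pos (cut⁺ u) (∈-allFin w) uw) k≤a (count-cut⁺≤OPT u)) ⟩
    [ s u w ]· frac OPT a ℚ.+ [ cut⁺ u w ]· frac (3 * OPT) k ∎
    where
    open ℚP.≤-Reasoning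
    k≤a : k ≤ a
    k≤a = count-mono V λ w → proj₁ ∘ Equivalence.to T-∧

  Σ-cut⁻≤ : Σ V cut⁻-term ℚ.≤ frac OPT 1 ℚ.+ frac (3 * OPT) 1
  Σ-cut⁻≤ = begin
    Σ V cut⁻-term
      ≡⟨ Σ-cong V (λ v → cong ([ cut⁻ u v ]·_) (commonPos-as-Σ v)) ⟩
    Σ V (λ v → [ cut⁻ u v ]· Σ V (λ w → [ s u w ∧ s v w ]· weight v))
      ≡⟨ Σ-cong V (λ v → []·-Σ (cut⁻ u v) V _) ⟩
    Σ V (λ v → Σ V (λ w → [ cut⁻ u v ]· ([ s u w ∧ s v w ]· weight v)))
      ≡⟨ Σ-comm V V _ ⟩
    Σ V (λ w → Σ V (λ v → [ cut⁻ u v ]· ([ s u w ∧ s v w ]· weight v)))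
      ≤⟨ Σ-mono V Σ-common-neighbour≤ ⟩
    Σ V (λ w → [ s u w ]· frac OPT a ℚ.+ [ cut⁺ u w ]· frac (3 * OPT) k)
      ≡⟨ trans (Σ-+ V _ _) (cong₂ ℚ._+_ (Σ-[]·-frac V (s u) OPT a) (Σ-[]·-frac V (cut⁺ u) (3 * OPT) k)) ⟩
    frac (a * OPT) a ℚ.+ frac (k * (3 * OPT)) k
      ≤⟨ ℚP.+-mono-≤ (frac-*-cancel-≤ a OPT) (frac-*-cancel-≤ k (3 * OPT)) ⟩
    frac OPT 1 ℚ.+ frac (3 * OPT) 1 ∎
    where
    open ℚP.≤-Reasoning
    commonPos-as-Σ : ∀ v → frac (commonPos s u v) (a ⊔ deg⁺ v) ≡ Σ V (λ w → [ s u w ∧ s v w ]· weight v)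
    commonPos-as-Σ v = sym (trans (Σ-[]·-frac V (λ w → s u w ∧ s v w) 1 (a ⊔ deg⁺ v))
                                  (cong (λ p → frac p (a ⊔ deg⁺ v)) (ℕP.*-identityʳ (commonPos s u v))))

lemma1 : (n : ℕ) (s : Signing n)
    → (∀ u v → s u v ≡ s v u)
    → (∀ u → s u u ≡ true)
    → (c : Clustering n) → IsMinMaxOptimal s c
    → ∀ (u : Fin n)
    → sumℚ (map (dHat s u) (vertices n)) ℚ.≤ (ℤ.+ (8 * maxDisagreement s c)) ℚ./ 1
lemma1 n s symm loop c _ u = begin
  Σ V (dHat s u)
    ≤⟨ Σ-mono V dHat-≤ ⟩
  Σ V (λ v → [ disagrees s c u v ]· 1ℚ ℚ.+ [ s u v ]· frac (2 * OPT) a ℚ.+ cut⁻-term v)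
    ≡⟨ trans (Σ-+ V _ cut⁻-term) (cong (ℚ._+ Σ V cut⁻-term) (Σ-+ V _ _)) ⟩
  Σ V (λ v → [ disagrees s c u v ]· 1ℚ) ℚ.+ Σ V (λ v → [ s u v ]· frac (2 * OPT) a) ℚ.+ Σ V cut⁻-term
    ≤⟨ ℚP.+-mono-≤ (ℚP.+-mono-≤ Σ-disagrees≤ Σ-positive≤) Σ-cut⁻≤ ⟩
  frac OPT 1 ℚ.+ frac (2 * OPT) 1 ℚ.+ (frac OPT 1 ℚ.+ frac (3 * OPT) 1)
    ≡⟨ trans (cong₂ ℚ._+_ (frac-+ OPT (2 * OPT) 1) (frac-+ OPT (3 * OPT) 1))
             (frac-+ (OPT + 2 * OPT) (OPT + 3 * OPT) 1) ⟩
  frac (OPT + 2 * OPT + (OPT + 3 * OPT)) 1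
    ≡⟨ cong (λ m → frac m 1) (solve 1 (λ o → o :+ con 2 :* o :+ (o :+ con 3 :* o) := con 7 :* o) refl OPT) ⟩
  frac (7 * OPT) 1
    ≤⟨ frac-monoˡ 1 (ℕP.*-monoˡ-≤ OPT (ℕP.n≤1+n 7)) ⟩
  frac (8 * OPT) 1 ∎
  where
  open ℚP.≤-Reasoning
  open import Data.Nat.Solver using (module +-*-Solver)
  open +-*-Solver
  open Disagreements s c
  open AtVertex s symm loop c u
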